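{- There exists $\mathcal{N}\in\mathbb{N}$ such that for all integers $m>\mathcal{N}$ and all positive integers $k\le 8m^3$ the following holds: if $X\in\mathbb{N}^k$ gives the numbers of robots at each of $k$ destinations when $m$ robots each independently choose one of the $k$ destinations uniformly at random, and $\|X\|_\infty=\max_i X_i$, then \[\mathbb{P}\Big(\|X\|_\infty>\tfrac{m}{k}\big(1+k^{3/4}\big)\Big)\le\frac{1}{2k}.\] -}

module Defs where

open import Data.Nat using (ℕ; zero; suc; _+_; _*_; _∸_; _^_; _<_; _⊔_; _<?_)
open import Data.Fin using (Fin; _≟_)
open import Data.List using (List; []; _∷_; [_]; map; concatMap; foldr; filter; length; allFin)
open import Data.Vec using (Vec) renaming ([] to []ᵛ; _∷_ to _∷ᵛ_)
open import Relation.Nullary using (yes; no)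

-- The sample space: all assignments of m robots to k destinations,
-- i.e. all vectors in (Fin k)^m, each listed exactly once.
-- The uniform distribution puts mass 1/k^m on each.
allAssignments : (k m : ℕ) → List (Vec (Fin k) m)
allAssignments k zero    = [ []ᵛ ]
allAssignments k (suc m) =
  concatMap (λ v → map (λ d → d ∷ᵛ v) (allFin k)) (allAssignments k m)

load : ∀ {k m} → Vec (Fin k) m → Fin k → ℕ
load []ᵛ        i = 0
load (d ∷ᵛ v) i with d ≟ i
... | yes _ = suc (load v i)
... | no  _ = load v i

maxLoad : ∀ {k m} → Vec (Fin k) m → ℕ
maxLoad {k} v = foldr _⊔_ 0 (map (load v) (allFin k))

-- The event ‖X‖_∞ > (m/k)(1 + k^{3/4}), written exactly over ℕ:
--   L > (m/k)(1 + k^{3/4})  ⟺  k L − m > m k^{3/4}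
--                           ⟺  k L > m  ∧  (k L − m)^4 > m^4 k^3
-- (for k ≥ 1); with truncated subtraction, if k L ≤ m the left side is 0
-- and the inequality 0 > m^4 k^3 fails (m ≥ 1), so one inequality suffices.
badCount : (k m : ℕ) → ℕ
badCount k m =
  length (filter (λ v → (m ^ 4) * (k ^ 3) <? (k * maxLoad v ∸ m) ^ 4)
                 (allAssignments k m))

-- A Chernoff-type argument with the potential Φ(v) = Σᵢ 2^(Xᵢ).  Adding one robot
-- multiplies the total of Φ over all assignments by k + 1, so Σ_v Φ(v) = k (k + 1)^m.
-- An assignment whose maximal load exceeds t has Φ(v) ≥ 2^(t+1), hence (Markov)
--   #overloaded · 2^(t+1) ≤ k (k + 1)^m ≤ k · 2^q · k^m,   q = ⌈2m/k⌉,
-- because (1 + 1/k)^⌈k/2⌉ ≤ 2.  Fix the dyadic scale u with 4 (2ᵘ)⁴ ≤ k < 64 (2ᵘ)⁴,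
-- so that r = 2 (2ᵘ)³ ≤ k^(3/4), and put t = q + 12 + 8u.  Once m ≥ 64 · 2ᵘ · (13 + 8u),
-- which holds for all large m because 2ᵘ ≲ m^(3/4), an overloaded assignment has
-- maximal load above t, and 2^(t+1) ≥ 2k² · 2^q gives #overloaded ≤ k^m / 2k.
-- For k < 4 no assignment is overloaded at all.

module Submission where

open import Defs
open import Data.Nat hiding (_≟_)
open import Data.Nat.Properties hiding (_≟_)
open import Data.Nat.DivMod using (_/_; _%_; m≡m%n+[m/n]*n; m%n<n; m/n*n≤m)
open import Data.Nat.ListAction using (sum)
open import Data.Nat.ListAction.Properties using (sum-++)
open import Data.Nat.Solver using (module +-*-Solver)
import Algebra.Properties.CommutativeSemigroup as CommSemigroupProperties
open import Data.Fin using (Fin; _≟_) renaming (zero to fzero; suc to fsuc)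
open import Data.Fin.Properties using () renaming (suc-injective to fsuc-injective)
open import Data.List using (List; []; _∷_; _++_; map; concatMap; foldr; filter; length; allFin; tabulate)
open import Data.List.Properties
  using (foldr-preservesᵇ; map-++; map-cong; map-∘; map-tabulate; tabulate-cong; length-tabulate; filter-none)
open import Data.List.Relation.Unary.All using (universal)
open import Data.List.Relation.Unary.All.Properties using (map⁺)
open import Data.Vec using (Vec) renaming ([] to []ᵛ; _∷_ to _∷ᵛ_)
open import Data.Product using (∃-syntax; _,_; _×_)
open import Data.Sum using (inj₁; inj₂)
open import Data.Empty using (⊥-elim)
open import Data.Unit using (tt)
open import Relation.Nullary using (yes; no; ¬_)
open import Relation.Unary using (Decidable)
open import Relation.Binary.PropositionalEquality
open import Function using (_∘_; const)

open +-*-Solver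
module +-CS = CommSemigroupProperties +-commutativeSemigroup
module *-CS = CommSemigroupProperties *-commutativeSemigroup

sum-map-+ : ∀ {A : Set} (f g : A → ℕ) xs →
            sum (map (λ x → f x + g x) xs) ≡ sum (map f xs) + sum (map g xs)
sum-map-+ f g [] = refl
sum-map-+ f g (x ∷ xs) = begin
  f x + g x + sum (map (λ x → f x + g x) xs)     ≡⟨ cong (f x + g x +_) (sum-map-+ f g xs) ⟩
  f x + g x + (sum (map f xs) + sum (map g xs))  ≡⟨ +-CS.interchange (f x) (g x) _ _ ⟩
  f x + sum (map f xs) + (g x + sum (map g xs))  ∎
  where open ≡-Reasoning

sum-map-*ˡ : ∀ {A : Set} c (f : A → ℕ) xs → sum (map (λ x → c * f x) xs) ≡ c * sum (map f xs)
sum-map-*ˡ c f [] = sym (*-zeroʳ c)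
sum-map-*ˡ c f (x ∷ xs) =
  trans (cong (c * f x +_) (sum-map-*ˡ c f xs)) (sym (*-distribˡ-+ c (f x) _))

sum-map-const : ∀ {A : Set} c (xs : List A) → sum (map (const c) xs) ≡ length xs * c
sum-map-const c [] = refl
sum-map-const c (x ∷ xs) = cong (c +_) (sum-map-const c xs)

sum-map-concatMap : ∀ {A B : Set} (g : B → ℕ) (f : A → List B) xs →
                    sum (map g (concatMap f xs)) ≡ sum (map (λ x → sum (map g (f x))) xs)
sum-map-concatMap g f [] = refl
sum-map-concatMap g f (x ∷ xs) = begin
  sum (map g (f x ++ concatMap f xs))              ≡⟨ cong sum (map-++ g (f x) (concatMap f xs)) ⟩
  sum (map g (f x) ++ map g (concatMap f xs))      ≡⟨ sum-++ (map g (f x)) _ ⟩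
  sum (map g (f x)) + sum (map g (concatMap f xs)) ≡⟨ cong (sum (map g (f x)) +_) (sum-map-concatMap g f xs) ⟩
  sum (map g (f x)) + sum (map (λ x → sum (map g (f x))) xs) ∎
  where open ≡-Reasoning

length-filter*≤sum : ∀ {A : Set} {P : A → Set} (P? : Decidable P) (f : A → ℕ) c xs →
                     (∀ x → P x → c ≤ f x) → length (filter P? xs) * c ≤ sum (map f xs)
length-filter*≤sum P? f c [] c≤f = z≤n
length-filter*≤sum P? f c (x ∷ xs) c≤f with P? x
... | yes px = +-mono-≤ (c≤f x px) (length-filter*≤sum P? f c xs c≤f)
... | no _   = ≤-trans (length-filter*≤sum P? f c xs c≤f) (m≤n+m _ _)

t<max⇒b^[1+t]≤sum : ∀ {A : Set} b .{{_ : NonZero b}} (f : A → ℕ) xs t → t < foldr _⊔_ 0 (map f xs) →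
                    b ^ suc t ≤ sum (map (λ x → b ^ f x) xs)
t<max⇒b^[1+t]≤sum b f (x ∷ xs) t t<max with ⊔-sel (f x) (foldr _⊔_ 0 (map f xs))
... | inj₁ eq = ≤-trans (^-monoʳ-≤ b (subst (t <_) eq t<max)) (m≤m+n _ _)
... | inj₂ eq = ≤-trans (t<max⇒b^[1+t]≤sum b f xs t (subst (t <_) eq t<max)) (m≤n+m _ _)

sum-tabulate-update : ∀ {k} (f g : Fin k → ℕ) d → (∀ i → d ≢ i → g i ≡ f i) →
                      sum (tabulate g) + f d ≡ sum (tabulate f) + g d
sum-tabulate-update f g fzero g≡f = begin
  g fzero + sum (tabulate (g ∘ fsuc)) + f fzero  ≡⟨ cong (λ s → g fzero + s + f fzero) tails-agree ⟩
  g fzero + sum (tabulate (f ∘ fsuc)) + f fzero  ≡⟨ +-CS.xy∙z≈zy∙x (g fzero) _ (f fzero) ⟩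
  f fzero + sum (tabulate (f ∘ fsuc)) + g fzero  ∎
  where
    open ≡-Reasoning
    tails-agree : sum (tabulate (g ∘ fsuc)) ≡ sum (tabulate (f ∘ fsuc))
    tails-agree = cong sum (tabulate-cong λ i → g≡f (fsuc i) λ ())
sum-tabulate-update f g (fsuc d) g≡f = begin
  g fzero + sum (tabulate (g ∘ fsuc)) + f (fsuc d)    ≡⟨ +-assoc (g fzero) _ _ ⟩
  g fzero + (sum (tabulate (g ∘ fsuc)) + f (fsuc d))  ≡⟨ cong₂ _+_ (g≡f fzero λ ()) tails-update ⟩
  f fzero + (sum (tabulate (f ∘ fsuc)) + g (fsuc d))  ≡⟨ +-assoc (f fzero) _ _ ⟨
  f fzero + sum (tabulate (f ∘ fsuc)) + g (fsuc d)    ∎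
  where
    open ≡-Reasoning
    tails-update : sum (tabulate (g ∘ fsuc)) + f (fsuc d) ≡ sum (tabulate (f ∘ fsuc)) + g (fsuc d)
    tails-update = sum-tabulate-update (f ∘ fsuc) (g ∘ fsuc) d λ i d≢i → g≡f (fsuc i) (d≢i ∘ fsuc-injective)

load-∷-≡ : ∀ {k m} (d : Fin k) (v : Vec (Fin k) m) → load (d ∷ᵛ v) d ≡ suc (load v d)
load-∷-≡ d v with d ≟ d
... | yes _   = refl
... | no d≢d = ⊥-elim (d≢d refl)

load-∷-≢ : ∀ {k m} {d i : Fin k} (v : Vec (Fin k) m) → d ≢ i → load (d ∷ᵛ v) i ≡ load v i
load-∷-≢ {d = d} {i} v d≢i with d ≟ i
... | yes d≡i = ⊥-elim (d≢i d≡i)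
... | no _    = refl

load≤length : ∀ {k m} (v : Vec (Fin k) m) i → load v i ≤ m
load≤length []ᵛ      i = z≤n
load≤length (d ∷ᵛ v) i with d ≟ i
... | yes _ = s≤s (load≤length v i)
... | no _  = m≤n⇒m≤1+n (load≤length v i)

maxLoad≤length : ∀ {k m} (v : Vec (Fin k) m) → maxLoad v ≤ m
maxLoad≤length {k} {m} v = foldr-preservesᵇ {P = _≤ m} ⊔-lub z≤n (map⁺ (universal (load≤length v) (allFin k)))

potential : ∀ {k m} → ℕ → Vec (Fin k) m → ℕ
potential {k} x v = sum (map (λ i → x ^ load v i) (allFin k))

sum-allFin : ∀ {k} (f : Fin k → ℕ) → sum (map f (allFin k)) ≡ sum (tabulate f)
sum-allFin f = cong sum (map-tabulate (λ i → i) f)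

potential-∷ : ∀ {k m} b (d : Fin k) (v : Vec (Fin k) m) →
              potential (suc b) (d ∷ᵛ v) ≡ b * suc b ^ load v d + potential (suc b) v
potential-∷ b d v = +-cancelʳ-≡ (f d) _ _ (begin
  potential x (d ∷ᵛ v) + f d      ≡⟨ cong (_+ f d) (sum-allFin g) ⟩
  sum (tabulate g) + f d          ≡⟨ sum-tabulate-update f g d (λ i d≢i → cong (x ^_) (load-∷-≢ v d≢i)) ⟩
  sum (tabulate f) + g d          ≡⟨ cong₂ _+_ (sym (sum-allFin f)) (cong (x ^_) (load-∷-≡ d v)) ⟩
  potential x v + (f d + b * f d) ≡⟨ +-CS.x∙yz≈zx∙y (potential x v) (f d) (b * f d) ⟩
  b * f d + potential x v + f d   ∎)
  where
    open ≡-Reasoning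
    x = suc b
    f g : _ → ℕ
    f i = x ^ load v i
    g i = x ^ load (d ∷ᵛ v) i

sum-potential-∷ : ∀ {k m} b (v : Vec (Fin k) m) →
                  sum (map (λ d → potential (suc b) (d ∷ᵛ v)) (allFin k)) ≡ (b + k) * potential (suc b) v
sum-potential-∷ {k} b v = begin
  sum (map (λ d → P (d ∷ᵛ v)) ds)                        ≡⟨ cong sum (map-cong (λ d → potential-∷ b d v) ds) ⟩
  sum (map (λ d → b * suc b ^ load v d + P v) ds)        ≡⟨ sum-map-+ _ (const (P v)) ds ⟩
  sum (map (λ d → b * suc b ^ load v d) ds) + sum (map (const (P v)) ds)
                                                         ≡⟨ cong₂ _+_ (sum-map-*ˡ b _ ds) (sum-map-const (P v) ds) ⟩
  b * P v + length ds * P v                              ≡⟨ cong (λ n → b * P v + n * P v) (length-tabulate {n = k} (λ i → i)) ⟩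
  b * P v + k * P v                                      ≡⟨ *-distribʳ-+ (P v) b k ⟨
  (b + k) * P v                                          ∎
  where
    open ≡-Reasoning
    ds = allFin k
    P : ∀ {n} → Vec (Fin k) n → ℕ
    P = potential (suc b)

sum-potential : ∀ b k m → sum (map (potential (suc b)) (allAssignments k m)) ≡ k * (b + k) ^ m
sum-potential b k zero = begin
  sum (map (const 1) (allFin k)) + 0 ≡⟨ +-identityʳ _ ⟩
  sum (map (const 1) (allFin k))     ≡⟨ sum-map-const 1 (allFin k) ⟩
  length (allFin k) * 1              ≡⟨ cong (_* 1) (length-tabulate {n = k} (λ i → i)) ⟩
  k * 1                              ∎
  where open ≡-Reasoning
sum-potential b k (suc m) = begin
  sum (map P (concatMap extensions vs))           ≡⟨ sum-map-concatMap P extensions vs ⟩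
  sum (map (λ v → sum (map P (extensions v))) vs) ≡⟨ cong sum (map-cong sum-extensions vs) ⟩
  sum (map (λ v → (b + k) * P v) vs)              ≡⟨ sum-map-*ˡ (b + k) P vs ⟩
  (b + k) * sum (map P vs)                        ≡⟨ cong ((b + k) *_) (sum-potential b k m) ⟩
  (b + k) * (k * (b + k) ^ m)                     ≡⟨ *-CS.x∙yz≈y∙xz (b + k) k _ ⟩
  k * (b + k) ^ suc m                             ∎
  where
    open ≡-Reasoning
    vs = allAssignments k m
    P : ∀ {n} → Vec (Fin k) n → ℕ
    P = potential (suc b)
    extensions : Vec (Fin k) m → List (Vec (Fin k) (suc m))
    extensions v = map (_∷ᵛ v) (allFin k)
    sum-extensions : ∀ v → sum (map P (extensions v)) ≡ (b + k) * P v
    sum-extensions v = trans (cong sum (sym (map-∘ (allFin k)))) (sum-potential-∷ b v)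

-- Bounds on (1 + 1/k)ⁿ

[1+k]^j*[1+e]≤k^j*[1+k] : ∀ j e {k} → j + e ≡ k → suc k ^ j * suc e ≤ k ^ j * suc k
[1+k]^j*[1+e]≤k^j*[1+k] zero    e refl = ≤-refl
[1+k]^j*[1+e]≤k^j*[1+k] (suc j) e refl = begin
  suc k ^ suc j * suc e          ≡⟨ *-assoc (suc k) (suc k ^ j) (suc e) ⟩
  suc k * (suc k ^ j * suc e)    ≡⟨ *-CS.x∙yz≈y∙xz (suc k) (suc k ^ j) (suc e) ⟩
  suc k ^ j * (suc k * suc e)    ≤⟨ *-monoʳ-≤ (suc k ^ j) [1+k]*[1+e]≤k*[2+e] ⟩
  suc k ^ j * (k * suc (suc e))  ≡⟨ *-CS.x∙yz≈y∙xz (suc k ^ j) k (suc (suc e)) ⟩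
  k * (suc k ^ j * suc (suc e))  ≤⟨ *-monoʳ-≤ k ([1+k]^j*[1+e]≤k^j*[1+k] j (suc e) (+-suc j e)) ⟩
  k * (k ^ j * suc k)            ≡⟨ *-assoc k (k ^ j) (suc k) ⟨
  k ^ suc j * suc k              ∎
  where
    open ≤-Reasoning
    k = suc j + e
    identity : ∀ j e → (suc j + e) * suc (suc e) ≡ suc (suc j + e) * suc e + j
    identity = solve 2 (λ j e → (con 1 :+ j :+ e) :* (con 2 :+ e) := (con 2 :+ j :+ e) :* (con 1 :+ e) :+ j) refl
    [1+k]*[1+e]≤k*[2+e] : suc k * suc e ≤ k * suc (suc e)
    [1+k]*[1+e]≤k*[2+e] = subst (suc k * suc e ≤_) (sym (identity j e)) (m≤m+n (suc k * suc e) j)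

2*m≡m+m : ∀ m → 2 * m ≡ m + m
2*m≡m+m m = cong (m +_) (+-identityʳ m)

2*m≤1+n⇒m≤n : ∀ m n → 2 * m ≤ suc n → m ≤ n
2*m≤1+n⇒m≤n zero    n _            = z≤n
2*m≤1+n⇒m≤n (suc m) n (s≤s 2m≤n) = subst (_≤ n) (+-identityʳ (suc m)) (m+n≤o⇒n≤o m 2m≤n)

[1+k]^j≤2*k^j : ∀ k j → 2 * j ≤ suc k → suc k ^ j ≤ 2 * k ^ j
[1+k]^j≤2*k^j k j 2j≤1+k with m≤n⇒∃[o]m+o≡n (2*m≤1+n⇒m≤n j k 2j≤1+k)
... | e , refl = *-cancelʳ-≤ _ _ (suc k) (begin
  suc k ^ j * suc k         ≤⟨ *-monoʳ-≤ (suc k ^ j) 1+k≤2*[1+e] ⟩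
  suc k ^ j * (2 * suc e)   ≡⟨ *-CS.x∙yz≈y∙xz (suc k ^ j) 2 (suc e) ⟩
  2 * (suc k ^ j * suc e)   ≤⟨ *-monoʳ-≤ 2 ([1+k]^j*[1+e]≤k^j*[1+k] j e refl) ⟩
  2 * (k ^ j * suc k)       ≡⟨ *-assoc 2 (k ^ j) (suc k) ⟨
  2 * k ^ j * suc k         ∎)
  where
    open ≤-Reasoning
    j≤1+e : j ≤ suc e
    j≤1+e = +-cancelˡ-≤ j _ _ (subst₂ _≤_ (2*m≡m+m j) (sym (+-suc j e)) 2j≤1+k)
    1+k≤2*[1+e] : suc (j + e) ≤ 2 * suc e
    1+k≤2*[1+e] = subst₂ _≤_ (+-suc j e) (sym (2*m≡m+m (suc e))) (+-monoˡ-≤ (suc e) j≤1+e)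

n≤2*⌈n/2⌉ : ∀ n → n ≤ 2 * ⌈ n /2⌉
n≤2*⌈n/2⌉ n = begin
  n                       ≡⟨ ⌊n/2⌋+⌈n/2⌉≡n n ⟨
  ⌊ n /2⌋ + ⌈ n /2⌉       ≤⟨ +-monoˡ-≤ ⌈ n /2⌉ (⌊n/2⌋≤⌈n/2⌉ n) ⟩
  ⌈ n /2⌉ + ⌈ n /2⌉       ≡⟨ 2*m≡m+m ⌈ n /2⌉ ⟨
  2 * ⌈ n /2⌉             ∎
  where open ≤-Reasoning

2*⌈n/2⌉≤1+n : ∀ n → 2 * ⌈ n /2⌉ ≤ suc n
2*⌈n/2⌉≤1+n n = begin
  2 * ⌈ n /2⌉                 ≡⟨ 2*m≡m+m ⌈ n /2⌉ ⟩
  ⌈ n /2⌉ + ⌈ n /2⌉           ≤⟨ +-monoʳ-≤ ⌈ n /2⌉ (⌈n/2⌉-mono (n≤1+n n)) ⟩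
  ⌊ suc n /2⌋ + ⌈ suc n /2⌉   ≡⟨ ⌊n/2⌋+⌈n/2⌉≡n (suc n) ⟩
  suc n                       ∎
  where open ≤-Reasoning

[1+k]^n≤2^q*k^n : ∀ k q n → 2 * n ≤ q * k → suc k ^ n ≤ 2 ^ q * k ^ n
[1+k]^n≤2^q*k^n k zero    zero _ = ≤-refl
[1+k]^n≤2^q*k^n k (suc q) n 2n≤[1+q]k with n ≤? ⌈ k /2⌉
... | yes n≤s = begin
  suc k ^ n          ≤⟨ [1+k]^j≤2*k^j k n (≤-trans (*-monoʳ-≤ 2 n≤s) (2*⌈n/2⌉≤1+n k)) ⟩
  2 * k ^ n          ≤⟨ *-monoˡ-≤ (k ^ n) (*-monoʳ-≤ 2 (m^n>0 2 q)) ⟩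
  2 ^ suc q * k ^ n  ∎
  where open ≤-Reasoning
... | no n≰s = subst (λ n → suc k ^ n ≤ 2 ^ suc q * k ^ n) (m+[n∸m]≡n s≤n) (begin
  suc k ^ (s + n′)                ≡⟨ ^-distribˡ-+-* (suc k) s n′ ⟩
  suc k ^ s * suc k ^ n′          ≤⟨ *-mono-≤ ([1+k]^j≤2*k^j k s (2*⌈n/2⌉≤1+n k)) ([1+k]^n≤2^q*k^n k q n′ 2n′≤qk) ⟩
  (2 * k ^ s) * (2 ^ q * k ^ n′)  ≡⟨ [m*n]*[o*p]≡[m*o]*[n*p] 2 (k ^ s) (2 ^ q) (k ^ n′) ⟩
  2 ^ suc q * (k ^ s * k ^ n′)    ≡⟨ cong (2 ^ suc q *_) (^-distribˡ-+-* k s n′) ⟨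
  2 ^ suc q * k ^ (s + n′)        ∎)
  where
    open ≤-Reasoning
    s  = ⌈ k /2⌉
    n′ = n ∸ s
    s≤n : s ≤ n
    s≤n = <⇒≤ (≰⇒> n≰s)
    2n′≤qk : 2 * n′ ≤ q * k
    2n′≤qk = begin
      2 * (n ∸ s)         ≡⟨ *-distribˡ-∸ 2 n s ⟩
      2 * n ∸ 2 * s       ≤⟨ ∸-mono 2n≤[1+q]k (n≤2*⌈n/2⌉ k) ⟩
      k + q * k ∸ k       ≡⟨ m+n∸m≡n k (q * k) ⟩
      q * k               ∎

ceiling-multiple : ∀ n s .{{_ : NonZero s}} → ∃[ q ] (n ≤ q * s × q * s ≤ n + s)
ceiling-multiple n s = suc (n / s) , n≤[1+n/s]*s , [1+n/s]*s≤n+s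
  where
    open ≤-Reasoning
    n≤[1+n/s]*s : n ≤ s + n / s * s
    n≤[1+n/s]*s = begin
      n                  ≡⟨ m≡m%n+[m/n]*n n s ⟩
      n % s + n / s * s  ≤⟨ +-monoˡ-≤ (n / s * s) (<⇒≤ (m%n<n n s)) ⟩
      s + n / s * s      ∎
    [1+n/s]*s≤n+s : s + n / s * s ≤ n + s
    [1+n/s]*s≤n+s = subst (s + n / s * s ≤_) (+-comm s n) (+-monoʳ-≤ s (m/n*n≤m n s))

Overloaded : ∀ {k m} → Vec (Fin k) m → Set
Overloaded {k} {m} v = m ^ 4 * k ^ 3 < (k * maxLoad v ∸ m) ^ 4

overloaded? : ∀ k m → Decidable (Overloaded {k} {m})
overloaded? k m v = m ^ 4 * k ^ 3 <? (k * maxLoad v ∸ m) ^ 4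

overloaded⇒<maxLoad : ∀ {k m} r t (v : Vec (Fin k) m) → k * t ≤ m + m * r → r ^ 4 ≤ k ^ 3 →
                      Overloaded v → t < maxLoad v
overloaded⇒<maxLoad {k} {m} r t v kt≤m+mr r⁴≤k³ overloaded = ≰⇒> λ max≤t →
  <⇒≱ overloaded (begin
    (k * maxLoad v ∸ m) ^ 4  ≤⟨ ^-monoˡ-≤ 4 (m≤n+o⇒m∸n≤o _ m (≤-trans (*-monoʳ-≤ k max≤t) kt≤m+mr)) ⟩
    (m * r) ^ 4              ≡⟨ [m*n]^4≡m^4*n^4 m r ⟩
    m ^ 4 * r ^ 4            ≤⟨ *-monoʳ-≤ (m ^ 4) r⁴≤k³ ⟩
    m ^ 4 * k ^ 3            ∎)
  where
    open ≤-Reasoning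
    [m*n]^4≡m^4*n^4 : ∀ m n → (m * n) ^ 4 ≡ m ^ 4 * n ^ 4
    [m*n]^4≡m^4*n^4 = solve 2 (λ m n → (m :* n) :^ 4 := m :^ 4 :* n :^ 4) refl

badCount*2^[1+t]≤k*[1+k]^m : ∀ k m r t → k * t ≤ m + m * r → r ^ 4 ≤ k ^ 3 →
                             badCount k m * 2 ^ suc t ≤ k * suc k ^ m
badCount*2^[1+t]≤k*[1+k]^m k m r t kt≤m+mr r⁴≤k³ =
  subst (badCount k m * 2 ^ suc t ≤_) (sum-potential 1 k m)
    (length-filter*≤sum (overloaded? k m) (potential 2) (2 ^ suc t) (allAssignments k m) 2^[1+t]≤potential)
  where
    2^[1+t]≤potential : ∀ v → Overloaded v → 2 ^ suc t ≤ potential 2 v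
    2^[1+t]≤potential v overloaded =
      t<max⇒b^[1+t]≤sum 2 (load v) (allFin k) t (overloaded⇒<maxLoad r t v kt≤m+mr r⁴≤k³ overloaded)

badCount≡0 : ∀ k m r → k ≤ suc r → r ^ 4 ≤ k ^ 3 → badCount k m ≡ 0
badCount≡0 k m r k≤1+r r⁴≤k³ = cong length (filter-none (overloaded? k m) (universal never (allAssignments k m)))
  where
    km≤m+mr : k * m ≤ m + m * r
    km≤m+mr = ≤-trans (*-monoˡ-≤ m k≤1+r) (≤-reflexive (cong (m +_) (*-comm r m)))
    never : ∀ v → ¬ Overloaded v
    never v overloaded = <⇒≱ (overloaded⇒<maxLoad r m v km≤m+mr r⁴≤k³ overloaded) (maxLoad≤length v)

k<4⇒badCount≡0 : ∀ k m → k < 4 → badCount k m ≡ 0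
k<4⇒badCount≡0 0 m _ = badCount≡0 0 m 0 z≤n z≤n
k<4⇒badCount≡0 1 m _ = badCount≡0 1 m 0 ≤-refl z≤n
k<4⇒badCount≡0 2 m _ = badCount≡0 2 m 1 ≤-refl (≤ᵇ⇒≤ 1 8 tt)
k<4⇒badCount≡0 3 m _ = badCount≡0 3 m 2 ≤-refl (≤ᵇ⇒≤ 16 27 tt)
k<4⇒badCount≡0 (suc (suc (suc (suc _)))) m (s≤s (s≤s (s≤s (s≤s ()))))

-- The dyadic scale and the number of robots

n<2^n : ∀ n → n < 2 ^ n
n<2^n zero    = s≤s z≤n
n<2^n (suc n) = +-mono-≤ (m^n>0 2 n) (≤-trans (n<2^n n) (m≤m+n (2 ^ n) 0))

dyadic-scale : ∀ k → 4 ≤ k → ∃[ u ] (4 * (2 ^ u) ^ 4 ≤ k × k < 64 * (2 ^ u) ^ 4)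
dyadic-scale k 4≤k = descend k k<64*[2^k]^4
  where
    k<64*[2^k]^4 : k < 64 * (2 ^ k) ^ 4
    k<64*[2^k]^4 = <-≤-trans (n<2^n k) (≤-trans 2^k≤[2^k]^4 (m≤n*m _ 64))
      where
        2^k≤[2^k]^4 : 2 ^ k ≤ (2 ^ k) ^ 4
        2^k≤[2^k]^4 = m≤m*n (2 ^ k) ((2 ^ k) ^ 3) {{m^n≢0 (2 ^ k) 3 {{m^n≢0 2 k}}}}
    64*x⁴≡4*[2x]⁴ : ∀ x → 64 * x ^ 4 ≡ 4 * (2 * x) ^ 4
    64*x⁴≡4*[2x]⁴ = solve 1 (λ x → con 64 :* x :^ 4 := con 4 :* (con 2 :* x) :^ 4) refl
    descend : ∀ u → k < 64 * (2 ^ u) ^ 4 → ∃[ u ] (4 * (2 ^ u) ^ 4 ≤ k × k < 64 * (2 ^ u) ^ 4)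
    descend zero    k<64 = zero , 4≤k , k<64
    descend (suc u) k<64*[2^[1+u]]^4 with k <? 64 * (2 ^ u) ^ 4
    ... | yes k<64*[2^u]^4 = descend u k<64*[2^u]^4
    ... | no  k≮64*[2^u]^4 =
      suc u , subst (_≤ k) (64*x⁴≡4*[2x]⁴ (2 ^ u)) (≮⇒≥ k≮64*[2^u]^4) , k<64*[2^[1+u]]^4

[1+x]^3≤2*x^3 : ∀ x → 4 ≤ x → suc x ^ 3 ≤ 2 * x ^ 3
[1+x]^3≤2*x^3 x 4≤x with m≤n⇒∃[o]m+o≡n 4≤x
... | n , refl = subst (suc (4 + n) ^ 3 ≤_) (sym (identity n)) (m≤m+n _ _)
  where
    identity : ∀ n → 2 * (4 + n) ^ 3 ≡ (5 + n) ^ 3 + (n ^ 3 + 9 * n ^ 2 + 21 * n + 3)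
    identity = solve 1 (λ n → con 2 :* (con 4 :+ n) :^ 3
                            := (con 5 :+ n) :^ 3 :+ (n :^ 3 :+ con 9 :* n :^ 2 :+ con 21 :* n :+ con 3)) refl

[j+x]^3<2^[j+e] : ∀ x e → 4 ≤ x → x ^ 3 < 2 ^ e → ∀ j → (j + x) ^ 3 < 2 ^ (j + e)
[j+x]^3<2^[j+e] x e 4≤x x³<2^e zero    = x³<2^e
[j+x]^3<2^[j+e] x e 4≤x x³<2^e (suc j) = begin-strict
  suc (j + x) ^ 3    ≤⟨ [1+x]^3≤2*x^3 (j + x) (≤-trans 4≤x (m≤n+m x j)) ⟩
  2 * (j + x) ^ 3    <⟨ *-monoʳ-< 2 ([j+x]^3<2^[j+e] x e 4≤x x³<2^e j) ⟩
  2 * 2 ^ (j + e)    ∎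
  where open ≤-Reasoning

2^31*u^3<2^u : ∀ u → 50 ≤ u → 2 ^ 31 * u ^ 3 < 2 ^ u
-- The numeral is kept to the right of _+_: in (50 + j) ^ 3 it would unfold into
-- about 10⁵ successors during conversion checking.
2^31*u^3<2^u u 50≤u = subst (λ u → 2 ^ 31 * u ^ 3 < 2 ^ u) (m∸n+n≡m 50≤u) (begin-strict
  2 ^ 31 * (j + 50) ^ 3    <⟨ *-monoʳ-< (2 ^ 31) ([j+x]^3<2^[j+e] 50 19 (≤ᵇ⇒≤ 4 50 tt) (≤ᵇ⇒≤ _ _ tt) j) ⟩
  2 ^ 31 * 2 ^ (j + 19)    ≡⟨ *-comm (2 ^ 31) (2 ^ (j + 19)) ⟩
  2 ^ (j + 19) * 2 ^ 31    ≡⟨ ^-distribˡ-+-* 2 (j + 19) 31 ⟨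
  2 ^ (j + 19 + 31)        ≡⟨ cong (2 ^_) (+-assoc j 19 31) ⟩
  2 ^ (j + 50)             ∎)
  where
    open ≤-Reasoning
    j = u ∸ 50

-- The number of robots needed at dyadic scale u: it makes k (13 + 8u) ≤ (2ᵘ)³ m
-- whenever k < 64 (2ᵘ)⁴.
minRobots : ℕ → ℕ
minRobots u = 64 * 2 ^ u * (13 + 8 * u)

minRobots-mono-≤ : ∀ {u v} → u ≤ v → minRobots u ≤ minRobots v
minRobots-mono-≤ u≤v = *-mono-≤ (*-monoʳ-≤ 64 (^-monoʳ-≤ 2 u≤v)) (+-monoʳ-≤ 13 (*-monoʳ-≤ 8 u≤v))

minRobots≤m : ∀ m u → minRobots 50 < m → (2 ^ u) ^ 4 ≤ 2 * m ^ 3 → minRobots u ≤ m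
minRobots≤m m u N<m a⁴≤2m³ with u ≤? 50
... | yes u≤50 = ≤-trans (minRobots-mono-≤ u≤50) (<⇒≤ N<m)
... | no  u≰50 = ≮⇒≥ λ m<N → <⇒≱ (2^31*u^3<2^u u 50≤u) (a≤2^31*u³ (<⇒≤ m<N))
  where
    open ≤-Reasoning
    50≤u = <⇒≤ (≰⇒> u≰50)
    a = 2 ^ u
    c = 13 + 8 * u
    -- Solved for a variable x instead of 64: normalising the numeral 2 · 64³ is very slow.
    2*[xac]^3≡2x^3c^3*a^3 : ∀ x a c → 2 * (x * a * c) ^ 3 ≡ (2 * x ^ 3 * c ^ 3) * a ^ 3
    2*[xac]^3≡2x^3c^3*a^3 = solve 3 (λ x a c → con 2 :* (x :* a :* c) :^ 3 := (con 2 :* x :^ 3 :* c :^ 3) :* a :^ 3) refl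
    [16u]^3≡4096*u^3 : ∀ u → (16 * u) ^ 3 ≡ 4096 * u ^ 3
    [16u]^3≡4096*u^3 = solve 1 (λ u → (con 16 :* u) :^ 3 := con 4096 :* u :^ 3) refl
    c≤16u : c ≤ 16 * u
    c≤16u = subst (c ≤_) (identity u) (+-monoˡ-≤ (8 * u) (≤-trans (≤ᵇ⇒≤ 13 400 tt) (*-monoʳ-≤ 8 50≤u)))
      where identity : ∀ u → 8 * u + 8 * u ≡ 16 * u
            identity = solve 1 (λ u → con 8 :* u :+ con 8 :* u := con 16 :* u) refl
    a≤2^31*u³ : m ≤ minRobots u → a ≤ 2 ^ 31 * u ^ 3
    a≤2^31*u³ m≤N = begin
      a                         ≤⟨ *-cancelʳ-≤ a (2 ^ 19 * c ^ 3) (a ^ 3) {{m^n≢0 a 3 {{m^n≢0 2 u}}}} (begin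
        a * a ^ 3                 ≤⟨ a⁴≤2m³ ⟩
        2 * m ^ 3                 ≤⟨ *-monoʳ-≤ 2 (^-monoˡ-≤ 3 m≤N) ⟩
        2 * (64 * a * c) ^ 3      ≡⟨ 2*[xac]^3≡2x^3c^3*a^3 64 a c ⟩
        (2 ^ 19 * c ^ 3) * a ^ 3  ∎) ⟩
      2 ^ 19 * c ^ 3            ≤⟨ *-monoʳ-≤ (2 ^ 19) (^-monoˡ-≤ 3 c≤16u) ⟩
      2 ^ 19 * (16 * u) ^ 3     ≡⟨ cong (2 ^ 19 *_) ([16u]^3≡4096*u^3 u) ⟩
      2 ^ 19 * (4096 * u ^ 3)   ≡⟨ *-assoc (2 ^ 19) 4096 (u ^ 3) ⟨
      2 ^ 31 * u ^ 3            ∎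

[2a³]⁴≤k³ : ∀ a k → 4 * a ^ 4 ≤ k → (2 * a ^ 3) ^ 4 ≤ k ^ 3
[2a³]⁴≤k³ a k 4a⁴≤k = begin
  (2 * a ^ 3) ^ 4   ≡⟨ identity₁ a ⟩
  16 * (a ^ 4) ^ 3  ≤⟨ *-monoˡ-≤ ((a ^ 4) ^ 3) (≤ᵇ⇒≤ 16 64 tt) ⟩
  64 * (a ^ 4) ^ 3  ≡⟨ identity₂ a ⟩
  (4 * a ^ 4) ^ 3   ≤⟨ ^-monoˡ-≤ 3 4a⁴≤k ⟩
  k ^ 3             ∎
  where
    open ≤-Reasoning
    identity₁ : ∀ a → (2 * a ^ 3) ^ 4 ≡ 16 * (a ^ 4) ^ 3
    identity₁ = solve 1 (λ a → (con 2 :* a :^ 3) :^ 4 := con 16 :* (a :^ 4) :^ 3) refl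
    identity₂ : ∀ a → 64 * (a ^ 4) ^ 3 ≡ (4 * a ^ 4) ^ 3
    identity₂ = solve 1 (λ a → con 64 :* (a :^ 4) :^ 3 := (con 4 :* a :^ 4) :^ 3) refl

k*t≤m+m*r : ∀ m k u q → k < 64 * (2 ^ u) ^ 4 → q * k ≤ 2 * m + k → minRobots u ≤ m →
            k * (q + (12 + 8 * u)) ≤ m + m * (2 * (2 ^ u) ^ 3)
k*t≤m+m*r m k u q k<64a⁴ qk≤2m+k N≤m = begin
  k * (q + (12 + 8 * u))         ≡⟨ *-distribˡ-+ k q (12 + 8 * u) ⟩
  k * q + k * (12 + 8 * u)       ≡⟨ cong (_+ k * (12 + 8 * u)) (*-comm k q) ⟩
  q * k + k * (12 + 8 * u)       ≤⟨ +-monoˡ-≤ (k * (12 + 8 * u)) qk≤2m+k ⟩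
  2 * m + k + k * (12 + 8 * u)   ≡⟨ identity₁ m k (8 * u) ⟩
  2 * m + k * c                  ≤⟨ +-monoʳ-≤ (2 * m) kc≤a³m ⟩
  2 * m + a ^ 3 * m              ≤⟨ 2m+a³m≤m+m[2a³] ⟩
  m + m * (2 * a ^ 3)            ∎
  where
    open ≤-Reasoning
    a = 2 ^ u
    c = 13 + 8 * u
    identity₁ : ∀ m k x → 2 * m + k + k * (12 + x) ≡ 2 * m + k * (13 + x)
    identity₁ = solve 3 (λ m k x → con 2 :* m :+ k :+ k :* (con 12 :+ x) := con 2 :* m :+ k :* (con 13 :+ x)) refl
    identity₂ : ∀ a c → (64 * a ^ 4) * c ≡ a ^ 3 * (64 * a * c)
    identity₂ = solve 2 (λ a c → (con 64 :* a :^ 4) :* c := a :^ 3 :* (con 64 :* a :* c)) refl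
    kc≤a³m : k * c ≤ a ^ 3 * m
    kc≤a³m = begin
      k * c                  ≤⟨ *-monoˡ-≤ c (<⇒≤ k<64a⁴) ⟩
      (64 * a ^ 4) * c       ≡⟨ identity₂ a c ⟩
      a ^ 3 * (64 * a * c)   ≤⟨ *-monoʳ-≤ (a ^ 3) N≤m ⟩
      a ^ 3 * m              ∎
    2m+a³m≤m+m[2a³] : 2 * m + a ^ 3 * m ≤ m + m * (2 * a ^ 3)
    2m+a³m≤m+m[2a³] = subst₂ _≤_ (identity₃ m (a ^ 3)) (identity₄ m (a ^ 3))
      (+-monoʳ-≤ (m + a ^ 3 * m) (m≤n*m m (a ^ 3) {{m^n≢0 a 3 {{m^n≢0 2 u}}}}))
      where
        identity₃ : ∀ m x → m + x * m + m ≡ 2 * m + x * m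
        identity₃ = solve 2 (λ m x → m :+ x :* m :+ m := con 2 :* m :+ x :* m) refl
        identity₄ : ∀ m x → m + x * m + x * m ≡ m + m * (2 * x)
        identity₄ = solve 2 (λ m x → m :+ x :* m :+ x :* m := m :+ m :* (con 2 :* x)) refl

2*k*k≤2^[13+8u] : ∀ k u → k < 64 * (2 ^ u) ^ 4 → 2 * k * k ≤ 2 ^ (13 + 8 * u)
2*k*k≤2^[13+8u] k u k<64a⁴ = begin
  2 * k * k                                    ≤⟨ *-mono-≤ (*-monoʳ-≤ 2 k≤64a⁴) k≤64a⁴ ⟩
  2 * (64 * (2 ^ u) ^ 4) * (64 * (2 ^ u) ^ 4)  ≡⟨ identity (2 ^ u) ⟩
  2 ^ 13 * (2 ^ u) ^ 8                         ≡⟨ cong (2 ^ 13 *_) (^-*-assoc 2 u 8) ⟩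
  2 ^ 13 * 2 ^ (u * 8)                         ≡⟨ cong (λ e → 2 ^ 13 * 2 ^ e) (*-comm u 8) ⟩
  2 ^ 13 * 2 ^ (8 * u)                         ≡⟨ ^-distribˡ-+-* 2 13 (8 * u) ⟨
  2 ^ (13 + 8 * u)                             ∎
  where
    open ≤-Reasoning
    k≤64a⁴ = <⇒≤ k<64a⁴
    identity : ∀ a → 2 * (64 * a ^ 4) * (64 * a ^ 4) ≡ 8192 * a ^ 8
    identity = solve 1 (λ a → con 2 :* (con 64 :* a :^ 4) :* (con 64 :* a :^ 4) := con 8192 :* a :^ 8) refl

4≤k⇒2k*badCount≤k^m : ∀ m k → minRobots 50 < m → 4 ≤ k → k ≤ 8 * m ^ 3 → 2 * k * badCount k m ≤ k ^ m
4≤k⇒2k*badCount≤k^m m k N<m 4≤k k≤8m³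
  with dyadic-scale k 4≤k | ceiling-multiple (2 * m) k {{>-nonZero (≤-trans (s≤s z≤n) 4≤k)}}
... | u , 4a⁴≤k , k<64a⁴ | q , 2m≤qk , qk≤2m+k =
  *-cancelʳ-≤ (2 * k * b) (k ^ m) (2 ^ suc t) {{m^n≢0 2 (suc t)}} (begin
    2 * k * b * 2 ^ suc t               ≡⟨ *-assoc (2 * k) b (2 ^ suc t) ⟩
    2 * k * (b * 2 ^ suc t)             ≤⟨ *-monoʳ-≤ (2 * k) (badCount*2^[1+t]≤k*[1+k]^m k m r t kt≤m+mr r⁴≤k³) ⟩
    2 * k * (k * suc k ^ m)             ≤⟨ *-monoʳ-≤ (2 * k) (*-monoʳ-≤ k ([1+k]^n≤2^q*k^n k q m 2m≤qk)) ⟩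
    2 * k * (k * (2 ^ q * k ^ m))       ≡⟨ *-assoc (2 * k) k (2 ^ q * k ^ m) ⟨
    2 * k * k * (2 ^ q * k ^ m)         ≤⟨ *-monoˡ-≤ (2 ^ q * k ^ m) (2*k*k≤2^[13+8u] k u k<64a⁴) ⟩
    2 ^ (13 + 8 * u) * (2 ^ q * k ^ m)  ≡⟨ *-CS.x∙yz≈z∙yx (2 ^ (13 + 8 * u)) (2 ^ q) (k ^ m) ⟩
    k ^ m * (2 ^ q * 2 ^ (13 + 8 * u))  ≡⟨ cong (k ^ m *_) 2^q*2^[13+8u]≡2^[1+t] ⟩
    k ^ m * 2 ^ suc t                   ∎)
  where
    open ≤-Reasoning
    b = badCount k m
    t = q + (12 + 8 * u)
    r = 2 * (2 ^ u) ^ 3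
    r⁴≤k³ : r ^ 4 ≤ k ^ 3
    r⁴≤k³ = [2a³]⁴≤k³ (2 ^ u) k 4a⁴≤k
    a⁴≤2m³ : (2 ^ u) ^ 4 ≤ 2 * m ^ 3
    a⁴≤2m³ = *-cancelˡ-≤ 4 (≤-trans 4a⁴≤k (subst (k ≤_) (*-assoc 4 2 (m ^ 3)) k≤8m³))
    kt≤m+mr : k * t ≤ m + m * r
    kt≤m+mr = k*t≤m+m*r m k u q k<64a⁴ qk≤2m+k (minRobots≤m m u N<m a⁴≤2m³)
    2^q*2^[13+8u]≡2^[1+t] : 2 ^ q * 2 ^ (13 + 8 * u) ≡ 2 ^ suc t
    2^q*2^[13+8u]≡2^[1+t] = trans (sym (^-distribˡ-+-* 2 q (13 + 8 * u))) (cong (2 ^_) (+-suc q (12 + 8 * u)))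

lemma5 : ∃[ N ] ((m : ℕ) → N < m → (k : ℕ) → 1 ≤ k → k ≤ 8 * m ^ 3 →
           2 * k * badCount k m ≤ k ^ m)
lemma5 = minRobots 50 , bound
  where
    bound : (m : ℕ) → minRobots 50 < m → (k : ℕ) → 1 ≤ k → k ≤ 8 * m ^ 3 → 2 * k * badCount k m ≤ k ^ m
    bound m N<m k _ k≤8m³ with k <? 4
    ... | yes k<4 rewrite k<4⇒badCount≡0 k m k<4 = ≤-trans (≤-reflexive (*-zeroʳ (2 * k))) z≤n
    ... | no  k≮4 = 4≤k⇒2k*badCount≤k^m m k N<m (≮⇒≥ k≮4) k≤8m³
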